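{- Let $\pi$ be a permutation that contains one of the patterns $2341, 25314, 42513, 42531, 45213, 45231, 52314, 642135, 642153$. Then $\pi$ cannot be sorted by two pop stacks in parallel with a bypass operation.
   Context: A permutation contains a pattern $\rho\in S_k$ if some length-$k$ subsequence has entries in the same relative order as $\rho$. The device "two pop stacks in parallel with a bypass" processes the entries of the input $\pi=\pi_1\cdots\pi_n$ from left to right; at each step one may push the current input entry on top of either of the two pop stacks, pop either pop stack (removing all its elements and appending them to the output from top to bottom), or bypass (append the current input entry directly to the output). At the end all pop stacks are emptied into the output. $\pi$ can be sorted if some sequence of such operations produces the output $12\cdots n$. -}

module Defs where

open import Data.Nat using (ℕ; suc; _<_)
open import Data.List using (List; []; _∷_; _++_; [_]; length; lookup; applyUpTo)
open import Data.List.Relation.Binary.Sublist.Propositional using (_⊆_)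
open import Data.List.Relation.Binary.Permutation.Propositional using (_↭_)
open import Data.Fin using (cast)
open import Data.Product using (Σ; ∃; _×_)
open import Function.Bundles using (_⇔_)
open import Relation.Binary.PropositionalEquality using (_≡_)
open import Relation.Binary.Construct.Closure.ReflexiveTransitive using (Star)

IsPerm : List ℕ → Set
IsPerm π = π ↭ applyUpTo suc (length π)

SameOrder : List ℕ → List ℕ → Set
SameOrder σ ρ =
  Σ (length σ ≡ length ρ) λ eq →
    ∀ i j → (lookup σ i < lookup σ j) ⇔ (lookup ρ (cast eq i) < lookup ρ (cast eq j))

Contains : List ℕ → List ℕ → Set
Contains π ρ = ∃ λ σ → σ ⊆ π × SameOrder σ ρ

-- Configuration of the device: remaining input, pop stack 1 (head = top),
-- pop stack 2 (head = top), output produced so far (in order).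
record Config : Set where
  constructor ⟨_,_,_,_⟩
  field
    input  : List ℕ
    stack1 : List ℕ
    stack2 : List ℕ
    output : List ℕ

data Step : Config → Config → Set where
  push1  : ∀ {x inp s₁ s₂ out} → Step ⟨ x ∷ inp , s₁ , s₂ , out ⟩ ⟨ inp , x ∷ s₁ , s₂ , out ⟩
  push2  : ∀ {x inp s₁ s₂ out} → Step ⟨ x ∷ inp , s₁ , s₂ , out ⟩ ⟨ inp , s₁ , x ∷ s₂ , out ⟩
  bypass : ∀ {x inp s₁ s₂ out} → Step ⟨ x ∷ inp , s₁ , s₂ , out ⟩ ⟨ inp , s₁ , s₂ , out ++ [ x ] ⟩
  pop1   : ∀ {inp s₁ s₂ out} → Step ⟨ inp , s₁ , s₂ , out ⟩ ⟨ inp , [] , s₂ , out ++ s₁ ⟩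
  pop2   : ∀ {inp s₁ s₂ out} → Step ⟨ inp , s₁ , s₂ , out ⟩ ⟨ inp , s₁ , [] , out ++ s₂ ⟩

-- π can be sorted: some sequence of operations (including the final emptying
-- of the pop stacks, which are pop operations) outputs 1 2 … n.
Sortable : List ℕ → Set
Sortable π = Star Step ⟨ π , [] , [] , [] ⟩ ⟨ [] , [] , [] , applyUpTo suc (length π) ⟩

patterns : List (List ℕ)
patterns =
  (2 ∷ 3 ∷ 4 ∷ 1 ∷ []) ∷
  (2 ∷ 5 ∷ 3 ∷ 1 ∷ 4 ∷ []) ∷
  (4 ∷ 2 ∷ 5 ∷ 1 ∷ 3 ∷ []) ∷
  (4 ∷ 2 ∷ 5 ∷ 3 ∷ 1 ∷ []) ∷
  (4 ∷ 5 ∷ 2 ∷ 1 ∷ 3 ∷ []) ∷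
  (4 ∷ 5 ∷ 2 ∷ 3 ∷ 1 ∷ []) ∷
  (5 ∷ 2 ∷ 3 ∷ 1 ∷ 4 ∷ []) ∷
  (6 ∷ 4 ∷ 2 ∷ 1 ∷ 3 ∷ 5 ∷ []) ∷
  (6 ∷ 4 ∷ 2 ∷ 1 ∷ 5 ∷ 3 ∷ []) ∷
  []

-- Restricting a run of the device to the entries of an occurrence σ of ρ in π,
-- renamed to the corresponding entries of ρ, is again a run: a push or bypass of
-- an entry outside σ just disappears, and a pop stays a pop.  Since the renaming
-- is increasing, a run sorting π restricts to a run on ρ whose output is
-- increasing.  So it suffices to check that no run on one of the nine patterns
-- outputs an increasing sequence, which an exhaustive search does.
module Submission where

open import Defs
open import Data.Unit using (tt)
open import Data.Bool using (Bool; true; false; T; _∧_; _∨_)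
open import Data.Bool.Properties using (T-∧; T-∨)
open import Data.Fin using (Fin; cast) renaming (zero to fzero; suc to fsuc)
open import Data.List using (List; []; _∷_; _++_; [_]; length; lookup; applyUpTo; mapMaybe; catMaybes)
open import Data.Bool.ListAction using (any)
open import Data.List.Properties using (++-assoc; ++-identityʳ; map-cong-local; mapMaybe-++)
open import Data.List.Membership.Propositional using (_∈_; lose)
open import Data.List.Membership.Propositional.Properties using (∈-++⁺ˡ; ∈-++⁺ʳ)
open import Data.List.Relation.Binary.Permutation.Propositional using (↭-sym; ↭⇒↭ₛ)
open import Data.List.Relation.Binary.Permutation.Setoid.Properties using (Unique-resp-↭)
open import Data.List.Relation.Binary.Sublist.Heterogeneous using ([]; _∷_; _∷ʳ_)
open import Data.List.Relation.Binary.Sublist.Propositional using (_⊆_)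
open import Data.List.Relation.Binary.Sublist.Propositional.Properties using (All-resp-⊆)
open import Data.List.Relation.Unary.All using (All; []; _∷_; all?)
import Data.List.Relation.Unary.All as All
import Data.List.Relation.Unary.All.Properties as All
open import Data.List.Relation.Unary.AllPairs using (AllPairs; []; _∷_; allPairs?)
import Data.List.Relation.Unary.AllPairs.Properties as AllPairs
open import Data.List.Relation.Unary.Any using (here; there)
open import Data.List.Relation.Unary.Any.Properties using (any⁺)
open import Data.List.Relation.Unary.Unique.Propositional using (Unique)
import Data.List.Relation.Unary.Unique.Propositional.Properties as Unique
open import Data.Maybe using (Maybe; just; nothing)
import Data.Maybe.Relation.Unary.All as Maybe
open import Data.Nat using (ℕ; zero; suc; pred; _*_; _<_; _≟_; _<?_; s≤s)
open import Data.Nat.Properties using (<⇒≢)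
open import Data.Product using (Σ; ∃; _×_; _,_; proj₁; proj₂)
open import Data.Sum using (_⊎_; inj₁; inj₂)
open import Function.Bundles using (Equivalence)
open import Relation.Binary.Construct.Closure.ReflexiveTransitive using (Star; ε; _◅_; kleisliStar)
open import Relation.Binary.PropositionalEquality
  using (_≡_; _≢_; refl; sym; trans; cong; subst; setoid; module ≡-Reasoning)
open import Relation.Nullary using (¬_; yes; no; ¬?; contradiction)
open import Relation.Nullary.Decidable using (isYes; T?; toWitness; fromWitness)

Sorted : List ℕ → Set
Sorted = AllPairs _<_

IncreasinglySortable : List ℕ → Set
IncreasinglySortable π =
  ∃ λ out → Sorted out × Star Step ⟨ π , [] , [] , [] ⟩ ⟨ [] , [] , [] , out ⟩

Sortable⇒IncreasinglySortable : ∀ {π} → Sortable π → IncreasinglySortable π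
Sortable⇒IncreasinglySortable {π} run =
  applyUpTo suc (length π) , AllPairs.applyUpTo⁺₁ suc (length π) (λ i<j _ → s≤s i<j) , run

permutation-unique : ∀ {π} → IsPerm π → Unique π
permutation-unique {π} perm =
  Unique-resp-↭ (setoid ℕ) (↭⇒↭ₛ (↭-sym perm))
    (Unique.applyUpTo⁺₁ suc (length π) (λ i<j _ → <⇒≢ (s≤s i<j)))

mapConfig : (ℕ → Maybe ℕ) → Config → Config
mapConfig g ⟨ inp , s₁ , s₂ , out ⟩ =
  ⟨ mapMaybe g inp , mapMaybe g s₁ , mapMaybe g s₂ , mapMaybe g out ⟩

step-mapConfig : ∀ g {c d} → Step c d → Star Step (mapConfig g c) (mapConfig g d)
step-mapConfig g (push1 {x}) with g x
... | just _  = push1 ◅ ε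
... | nothing = ε
step-mapConfig g (push2 {x}) with g x
... | just _  = push2 ◅ ε
... | nothing = ε
step-mapConfig g (bypass {x} {out = out}) rewrite mapMaybe-++ g out [ x ] with g x
... | just _  = bypass ◅ ε
... | nothing rewrite ++-identityʳ (mapMaybe g out) = ε
step-mapConfig g (pop1 {s₁ = s₁} {out = out}) rewrite mapMaybe-++ g out s₁ = pop1 ◅ ε
step-mapConfig g (pop2 {s₂ = s₂} {out = out}) rewrite mapMaybe-++ g out s₂ = pop2 ◅ ε

run-mapConfig : ∀ g {c d} → Star Step c d → Star Step (mapConfig g c) (mapConfig g d)
run-mapConfig g = kleisliStar (mapConfig g) (step-mapConfig g)

Monotone : (ℕ → Maybe ℕ) → Set
Monotone g = ∀ {x y a b} → g x ≡ just a → g y ≡ just b → x < y → a < b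

mapMaybe-sorted : ∀ {g} → Monotone g → ∀ {xs} → Sorted xs → Sorted (mapMaybe g xs)
mapMaybe-sorted {g} mono {[]} [] = []
mapMaybe-sorted {g} mono {x ∷ xs} (x<xs ∷ sorted) with g x in gx
... | nothing = mapMaybe-sorted mono sorted
... | just a  = All.mapMaybe⁺ (All.map⁺ (All.map above x<xs)) ∷ mapMaybe-sorted mono sorted
  where
  above : ∀ {y} → x < y → Maybe.All (a <_) (g y)
  above {y} x<y with g y in gy
  ... | just _  = Maybe.just (mono gx gy x<y)
  ... | nothing = Maybe.nothing

relabel : List ℕ → List ℕ → ℕ → Maybe ℕ
relabel []      _       x = nothing
relabel (_ ∷ _) []      x = nothing
relabel (s ∷ σ) (r ∷ ρ) x with x ≟ s
... | yes _ = just r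
... | no  _ = relabel σ ρ x

relabel-∉ : ∀ σ ρ {x} → All (x ≢_) σ → relabel σ ρ x ≡ nothing
relabel-∉ []      ρ       _ = refl
relabel-∉ (s ∷ σ) []      _ = refl
relabel-∉ (s ∷ σ) (r ∷ ρ) {x} (x≢s ∷ x∉σ) with x ≟ s
... | yes x≡s = contradiction x≡s x≢s
... | no  _   = relabel-∉ σ ρ x∉σ

relabel-head : ∀ s σ r ρ → relabel (s ∷ σ) (r ∷ ρ) s ≡ just r
relabel-head s σ r ρ with s ≟ s
... | yes _   = refl
... | no  s≢s = contradiction refl s≢s

relabel-tail : ∀ s σ r ρ {x} → s ≢ x → relabel (s ∷ σ) (r ∷ ρ) x ≡ relabel σ ρ x
relabel-tail s σ r ρ {x} s≢x with x ≟ s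
... | yes x≡s = contradiction (sym x≡s) s≢x
... | no  _   = refl

mapMaybe-relabel : ∀ {σ π ρ} → σ ⊆ π → Unique π → length σ ≡ length ρ →
                   mapMaybe (relabel σ ρ) π ≡ ρ
mapMaybe-relabel {ρ = []}    []            _              _   = refl
mapMaybe-relabel {σ} {ρ = ρ} (y ∷ʳ σ⊆π)    (y∉π ∷ unique) len
  rewrite relabel-∉ σ ρ (All-resp-⊆ σ⊆π y∉π) = mapMaybe-relabel σ⊆π unique len
mapMaybe-relabel {y ∷ σ} {y ∷ π} {r ∷ ρ} (refl ∷ σ⊆π) (y∉π ∷ unique) len
  rewrite relabel-head y σ r ρ = cong (r ∷_) (begin
    mapMaybe (relabel (y ∷ σ) (r ∷ ρ)) π
      ≡⟨ cong catMaybes (map-cong-local (All.map (relabel-tail y σ r ρ) y∉π)) ⟩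
    mapMaybe (relabel σ ρ) π
      ≡⟨ mapMaybe-relabel σ⊆π unique (cong pred len) ⟩
    ρ ∎)
  where open ≡-Reasoning

relabel-position : ∀ σ ρ {x a} → relabel σ ρ x ≡ just a → .(len : length σ ≡ length ρ) →
                   Σ (Fin (length σ)) λ i → lookup σ i ≡ x × lookup ρ (cast len i) ≡ a
relabel-position (s ∷ σ) (r ∷ ρ) {x} eq len with x ≟ s
relabel-position (s ∷ σ) (r ∷ ρ) refl len | yes x≡s = fzero , sym x≡s , refl
... | no _ with relabel-position σ ρ eq (cong pred len)
...   | i , σᵢ≡x , ρᵢ≡a = fsuc i , σᵢ≡x , ρᵢ≡a

relabel-monotone : ∀ {σ ρ} → SameOrder σ ρ → Monotone (relabel σ ρ)
relabel-monotone {σ} {ρ} (len , sameOrder) gx gy x<y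
  with relabel-position σ ρ gx len | relabel-position σ ρ gy len
... | i , refl , refl | j , refl , refl = Equivalence.to (sameOrder i j) x<y

IncreasinglySortable-pattern : ∀ {π ρ} → Unique π → Contains π ρ →
                               IncreasinglySortable π → IncreasinglySortable ρ
IncreasinglySortable-pattern {π} {ρ} unique (σ , σ⊆π , sameOrder) (out , sorted , run) =
  mapMaybe g out ,
  mapMaybe-sorted (relabel-monotone {σ} {ρ} sameOrder) sorted ,
  subst (λ inp → Star Step ⟨ inp , [] , [] , [] ⟩ ⟨ [] , [] , [] , mapMaybe g out ⟩)
        (mapMaybe-relabel σ⊆π unique (proj₁ sameOrder))
        (run-mapConfig g run)
  where
  g : ℕ → Maybe ℕ
  g = relabel σ ρ

open Config

step-output : ∀ {c d} → Step c d → ∃ λ ys → output d ≡ output c ++ ys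
step-output {c} push1              = [] , sym (++-identityʳ (output c))
step-output {c} push2              = [] , sym (++-identityʳ (output c))
step-output (bypass {x = x})       = [ x ] , refl
step-output (pop1 {s₁ = s₁})       = s₁ , refl
step-output (pop2 {s₂ = s₂})       = s₂ , refl

run-output : ∀ {c d} → Star Step c d → ∃ λ ys → output d ≡ output c ++ ys
run-output {c} ε = [] , sym (++-identityʳ (output c))
run-output {c} (s ◅ r) with step-output s | run-output r
... | xs , eq₁ | ys , eq₂ =
  xs ++ ys , trans eq₂ (trans (cong (_++ ys) eq₁) (++-assoc (output c) xs ys))

Sorted-++⁻ˡ : ∀ xs {ys} → Sorted (xs ++ ys) → Sorted xs
Sorted-++⁻ˡ []       _                  = []
Sorted-++⁻ˡ (x ∷ xs) (x<xsys ∷ sorted) = All.++⁻ˡ xs x<xsys ∷ Sorted-++⁻ˡ xs sorted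

isFinal : Config → Bool
isFinal ⟨ [] , [] , [] , _ ⟩ = true
isFinal _                    = false

-- Pops of empty stacks are left out: they do not change the configuration.
feeds pops₁ pops₂ moves : Config → List Config
feeds ⟨ []      , s₁ , s₂ , out ⟩ = []
feeds ⟨ x ∷ inp , s₁ , s₂ , out ⟩ =
  ⟨ inp , x ∷ s₁ , s₂ , out ⟩ ∷ ⟨ inp , s₁ , x ∷ s₂ , out ⟩ ∷ ⟨ inp , s₁ , s₂ , out ++ [ x ] ⟩ ∷ []
pops₁ ⟨ inp , []     , s₂ , out ⟩ = []
pops₁ ⟨ inp , x ∷ s₁ , s₂ , out ⟩ = [ ⟨ inp , [] , s₂ , out ++ x ∷ s₁ ⟩ ]
pops₂ ⟨ inp , s₁ , []     , out ⟩ = []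
pops₂ ⟨ inp , s₁ , x ∷ s₂ , out ⟩ = [ ⟨ inp , s₁ , [] , out ++ x ∷ s₂ ⟩ ]
moves c = feeds c ++ pops₁ c ++ pops₂ c

step-moves : ∀ {c d} → Step c d → d ∈ moves c ⊎ d ≡ c
step-moves push1  = inj₁ (here refl)
step-moves push2  = inj₁ (there (here refl))
step-moves bypass = inj₁ (there (there (here refl)))
step-moves {c} (pop1 {inp} {[]} {s₂} {out}) =
  inj₂ (cong (λ o → ⟨ inp , [] , s₂ , o ⟩) (++-identityʳ out))
step-moves {c} (pop1 {s₁ = _ ∷ _}) =
  inj₁ (∈-++⁺ʳ (feeds c) (∈-++⁺ˡ {ys = pops₂ c} (here refl)))
step-moves {c} (pop2 {inp} {s₁} {[]} {out}) =
  inj₂ (cong (λ o → ⟨ inp , s₁ , [] , o ⟩) (++-identityʳ out))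
step-moves {c} (pop2 {s₂ = _ ∷ _}) =
  inj₁ (∈-++⁺ʳ (feeds c) (∈-++⁺ʳ (pops₁ c) {pops₂ c} (here refl)))

sortedOutput : Config → Bool
sortedOutput c = isYes (allPairs? _<?_ (output c))

sortedOutput-complete : ∀ c → Sorted (output c) → T (sortedOutput c)
sortedOutput-complete c = fromWitness {a? = allPairs? _<?_ (output c)}

-- Running out of fuel counts as success, so a negative answer is conclusive.
search : ℕ → Config → Bool
search zero    c = true
search (suc f) c = sortedOutput c ∧ (isFinal c ∨ any (search f) (moves c))

search-complete : ∀ {c out} → Star Step c ⟨ [] , [] , [] , out ⟩ → Sorted out →
                  ∀ f → T (search f c)
search-complete run       sorted zero    = tt
search-complete {c} ε     sorted (suc f) =
  Equivalence.from (T-∧ {sortedOutput c}) (sortedOutput-complete c sorted , tt)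
search-complete {c} {out} (s ◅ r) sorted (suc f) with step-moves s
... | inj₂ refl = search-complete r sorted (suc f)
... | inj₁ d∈moves =
  Equivalence.from (T-∧ {sortedOutput c})
    ( sortedOutput-complete c (Sorted-++⁻ˡ (output c) (subst Sorted eq sorted))
    , Equivalence.from (T-∨ {isFinal c})
        (inj₂ (any⁺ (search f) (lose d∈moves (search-complete r sorted f)))))
  where
  eq : out ≡ output c ++ proj₁ (run-output (s ◅ r))
  eq = proj₂ (run-output (s ◅ r))

-- Every element is fed once and every move popping a nonempty stack outputs an
-- element, so a run avoiding empty pops has at most 2n moves.
fuel : List ℕ → ℕ
fuel ρ = suc (2 * length ρ)

patterns-unsortable : All (λ ρ → ¬ T (search (fuel ρ) ⟨ ρ , [] , [] , [] ⟩)) patterns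
patterns-unsortable =
  toWitness {a? = all? (λ ρ → ¬? (T? (search (fuel ρ) ⟨ ρ , [] , [] , [] ⟩))) patterns} tt

patterns-not-IncreasinglySortable : ∀ {ρ} → ρ ∈ patterns → ¬ IncreasinglySortable ρ
patterns-not-IncreasinglySortable {ρ} ρ∈patterns (out , sorted , run) =
  All.lookup patterns-unsortable ρ∈patterns (search-complete run sorted (fuel ρ))

mainTheorem12 : (π : List ℕ) → IsPerm π → (ρ : List ℕ) → ρ ∈ patterns → Contains π ρ → ¬ Sortable π
mainTheorem12 π perm ρ ρ∈patterns π⊇ρ sortable =
  patterns-not-IncreasinglySortable ρ∈patterns
    (IncreasinglySortable-pattern (permutation-unique perm) π⊇ρ
      (Sortable⇒IncreasinglySortable sortable))
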